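{- Assume $n\to\infty$ and $m=m(n)$ with $\alpha=m/n\in[0.5\log n,\log n]$. With probability $1-O((\log n)^{ -1})$ (under $\mathbb P_{\mathcal Y_1}$), the random sequence $\boldsymbol Y=Y_1\cdots Y_{n-\nu}$ is decomposable at none of the positions $n-2\nu,n-2\nu+1,\dots,n-\nu-1$.
   Context: Let $\nu=\lceil 2(\alpha+1)\log n\rceil$. Let $a_1,\dots,a_\nu$ be integers (possibly depending on $n$) with $0\le a_i\le i-1$ and $a=\sum a_i$. $\mathcal Y_1$ is the set of sequences $(y_1,\dots,y_{n-\nu})$ of nonnegative integers with $\sum_i y_i=m-a$; $\mathbb P_{\mathcal Y_1}$ is the uniform probability on $\mathcal Y_1$ and $\boldsymbol Y$ the random element. A sequence $b_1\cdots b_N$ of nonnegative integers is decomposable at $j\in[N-1]$ if $b_{j+i}\le i-1$ for all $i\in[N-j]$. -}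

module Defs where

open import Data.Nat using (ℕ; zero; suc; _+_; _*_; _∸_; _^_; _≤_; _<_; _≤ᵇ_; _!)
open import Data.Bool using (Bool)
open import Data.Fin using (Fin; toℕ)
open import Data.List using (List; []; _∷_; length; map; concatMap; upTo; filterᵇ; tabulate)
open import Data.Bool.ListAction using (all; any)
open import Data.Nat.ListAction using (sum)
open import Data.Product using (Σ; _×_)
open import Relation.Nullary using (¬_)

-- expNum B k = k! * Σ_{j=0}^{k} B^j / j!   (a natural number), so that
-- the k-th partial sum of the exponential series of e^B is expNum B k / k!.

expNum : ℕ → ℕ → ℕ
expNum B zero    = 1
expNum B (suc k) = suc k * expNum B k + B ^ suc k

-- e^B ≤ x   (e^B is the supremum of the increasing partial sums)
ExpLe : ℕ → ℕ → Set
ExpLe B x = ∀ k → expNum B k ≤ x * k !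

-- x ≤ e^B   (some partial sum reaches x; exact also when x = e^B, i.e. B = 0, x = 1)
LeExp : ℕ → ℕ → Set
LeExp x B = Σ ℕ λ k → x * k ! ≤ expNum B k

-- Natural logarithm conditions, for n ≥ 1 and m ≥ 0 (α = m/n):
--   (1/2) log n ≤ α   ⟺  n log n ≤ 2m    ⟺  n^n ≤ e^(2m)
HalfLogLeα : ℕ → ℕ → Set
HalfLogLeα n m = LeExp (n ^ n) (2 * m)

--   α ≤ log n         ⟺  m ≤ n log n     ⟺  e^m ≤ n^n
αLeLog : ℕ → ℕ → Set
αLeLog n m = ExpLe m (n ^ n)

-- ν = ⌈ 2(α+1) log n ⌉ , α = m/n, i.e.
--   2(α+1) log n ≤ ν   and   ¬ (2(α+1) log n ≤ ν - 1),
-- where  2(α+1) log n ≤ t  ⟺  2(m+n) log n ≤ t n  ⟺  n^(2(m+n)) ≤ e^(t n).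
IsNu : ℕ → ℕ → ℕ → Set
IsNu n m ν = LeExp (n ^ (2 * (m + n))) (ν * n)
           × ¬ LeExp (n ^ (2 * (m + n))) ((ν ∸ 1) * n)

compositions : ℕ → ℕ → List (List ℕ)
compositions zero    zero    = [] ∷ []
compositions zero    (suc s) = []
compositions (suc L) s       =
  concatMap (λ y → map (y ∷_) (compositions L (s ∸ y))) (upTo (suc s))

-- b_p (1-based); 0 out of range (never used out of range below).
at : List ℕ → ℕ → ℕ
at []       _             = 0
at (x ∷ xs) zero          = 0
at (x ∷ xs) (suc zero)    = x
at (x ∷ xs) (suc (suc p)) = at xs (suc p)

-- b₁⋯b_N is decomposable at j ∈ [N-1]:  b_{j+i} ≤ i - 1 for all i ∈ [N-j].
-- (i ranges over 1..N-j; written with i = i' + 1, i' ∈ 0..N-j-1.)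
decomposableAt : List ℕ → ℕ → Bool
decomposableAt b j = all (λ i' → at b (j + suc i') ≤ᵇ i') (upTo (length b ∸ j))

badEvent : ℕ → ℕ → List ℕ → Bool
badEvent n ν y = any (λ t → decomposableAt y ((n ∸ 2 * ν) + t)) (upTo ν)

𝒴₁ : ℕ → ℕ → ℕ → ℕ → List (List ℕ)
𝒴₁ n m ν a = compositions (n ∸ ν) (m ∸ a)

sumFin : ∀ {ν} → (Fin ν → ℕ) → ℕ
sumFin f = sum (tabulate f)

module Submission where

open import Defs
open import Data.Nat
open import Data.Nat.Properties
open import Data.Nat.DivMod using (_/_; _%_; m≡m%n+[m/n]*n; m%n<n; m/n*n≤m)
open import Data.Nat.ListAction using (sum; product)
open import Data.Nat.Tactic.RingSolver using (solve-∀)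
open import Data.Bool using (Bool; true; false; _∧_; _∨_; if_then_else_)
open import Data.Bool.ListAction using (and; all; any)
open import Data.List using (List; []; _∷_; length; map; concatMap; upTo; applyUpTo; filterᵇ; drop; _++_)
open import Data.List.Properties using (map-cong; map-upTo; map-applyUpTo)
open import Data.Product using (Σ; _,_)
open import Data.Fin using (Fin; toℕ)
import Data.Fin as Fin
open import Data.Fin.Properties using (toℕ<n)
open import Relation.Nullary using (¬_; yes; no; contradiction)
open import Relation.Binary.PropositionalEquality
open import Function using (_∘_; id)

-- Decomposability at j forces the entries after j to satisfy Y_{j+i} ≤ i - 1.  The
-- first of them is then 0, and if at least four entries follow j the next two take at
-- most 2 and 3 values, so (writing C(L) for the number of compositions of s into L
-- parts) each position carries at most C(N-1) decomposable sequences, and all but the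
-- last three at most 6·C(N-3).  A union bound gives #bad ≤ 3 C(N-1) + 6ν C(N-3), and
-- the absorption identity (s+L) C(L) = L C(L+1) turns this into
-- #bad ≤ 2427 (n/s) C(N) as soon as ν n² ≤ 101 m² and s ≥ m/2.
-- The hypotheses, stated through partial sums of the exponential series, are turned
-- into n ≤ m, n^n ≤ 2^(8m+2), ν n² ≤ 101 m² and 2ν² ≤ n (the record Regime); the last
-- gives a ≤ ν² ≤ m/2, and log n ≤ (8m+2)/n converts the count into the claimed bound.

sumUpTo : (ℕ → ℕ) → ℕ → ℕ
sumUpTo f k = sum (applyUpTo f k)

sumUpTo-cong : ∀ {f g} k → (∀ y → f y ≡ g y) → sumUpTo f k ≡ sumUpTo g k
sumUpTo-cong zero    f≗g = refl
sumUpTo-cong (suc k) f≗g = cong₂ _+_ (f≗g 0) (sumUpTo-cong k (f≗g ∘ suc))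

sumUpTo-mono : ∀ {f g} k → (∀ y → f y ≤ g y) → sumUpTo f k ≤ sumUpTo g k
sumUpTo-mono zero    f≤g = z≤n
sumUpTo-mono (suc k) f≤g = +-mono-≤ (f≤g 0) (sumUpTo-mono k (f≤g ∘ suc))

sumUpTo-scale : ∀ c f k → sumUpTo (λ y → c * f y) k ≡ c * sumUpTo f k
sumUpTo-scale c f zero    = sym (*-zeroʳ c)
sumUpTo-scale c f (suc k) = begin
  c * f 0 + sumUpTo (λ y → c * f (suc y)) k ≡⟨ cong (c * f 0 +_) (sumUpTo-scale c (f ∘ suc) k) ⟩
  c * f 0 + c * sumUpTo (f ∘ suc) k          ≡⟨ *-distribˡ-+ c (f 0) _ ⟨
  c * sumUpTo f (suc k)                      ∎
  where open ≡-Reasoning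

sumUpTo-bounded : ∀ {f} K k → (∀ y → y < k → f y ≤ K) → sumUpTo f k ≤ k * K
sumUpTo-bounded K zero    f≤K = z≤n
sumUpTo-bounded K (suc k) f≤K = +-mono-≤ (f≤K 0 (s≤s z≤n)) (sumUpTo-bounded K k (λ y → f≤K (suc y) ∘ s≤s))

sumUpTo-zero : ∀ k → sumUpTo (λ _ → 0) k ≡ 0
sumUpTo-zero zero    = refl
sumUpTo-zero (suc k) = sumUpTo-zero k

-- Only the terms y ≤ b of a guarded sum survive, so there are at most b + 1 of them.
sumUpTo-guarded : ∀ b {g : ℕ → ℕ} K k → (∀ y → g y ≤ K) →
  sumUpTo (λ y → if y ≤ᵇ b then g y else 0) k ≤ suc b * K
sumUpTo-guarded b       K zero    g≤K = z≤n
sumUpTo-guarded zero    K (suc k) g≤K =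
  +-mono-≤ (g≤K 0) (≤-reflexive (sumUpTo-zero k))
sumUpTo-guarded (suc b) {g} K (suc k) g≤K =
  +-mono-≤ (g≤K 0) (≤-trans (≤-reflexive (sumUpTo-cong k shift)) (sumUpTo-guarded b K k (g≤K ∘ suc)))
  where
  shift : ∀ y → (if suc y ≤ᵇ suc b then g (suc y) else 0) ≡ (if y ≤ᵇ b then g (suc y) else 0)
  shift zero    = refl
  shift (suc y) = refl

count : (List ℕ → Bool) → List (List ℕ) → ℕ
count P xs = length (filterᵇ P xs)

count-true : ∀ xs → count (λ _ → true) xs ≡ length xs
count-true []       = refl
count-true (x ∷ xs) = cong suc (count-true xs)

count-false : ∀ xs → count (λ _ → false) xs ≡ 0
count-false []       = refl
count-false (x ∷ xs) = count-false xs

count-∧ : ∀ c P xs → count (λ z → c ∧ P z) xs ≡ (if c then count P xs else 0)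
count-∧ false P xs = count-false xs
count-∧ true  P xs = refl

count-mono : ∀ {P Q} xs → (∀ z → P z ≡ true → Q z ≡ true) → count P xs ≤ count Q xs
count-mono {P} {Q} []       P⇒Q = z≤n
count-mono {P} {Q} (x ∷ xs) P⇒Q with P x in Px | Q x in Qx
... | true  | true  = s≤s (count-mono xs P⇒Q)
... | false | true  = m≤n⇒m≤1+n (count-mono xs P⇒Q)
... | false | false = count-mono xs P⇒Q
... | true  | false with () ← trans (sym (P⇒Q x Px)) Qx

count-∨ : ∀ P Q xs → count (λ z → P z ∨ Q z) xs ≤ count P xs + count Q xs
count-∨ P Q []       = z≤n
count-∨ P Q (x ∷ xs) with P x | Q x
... | true  | false = s≤s (count-∨ P Q xs)
... | true  | true  = s≤s (≤-trans (count-∨ P Q xs) (+-monoʳ-≤ (count P xs) (n≤1+n _)))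
... | false | true  = ≤-trans (s≤s (count-∨ P Q xs)) (≤-reflexive (sym (+-suc _ _)))
... | false | false = count-∨ P Q xs

count-any : ∀ (R : ℕ → List ℕ → Bool) ts xs →
  count (λ z → any (λ t → R t z) ts) xs ≤ sum (map (λ t → count (R t) xs) ts)
count-any R []       xs = ≤-reflexive (count-false xs)
count-any R (t ∷ ts) xs =
  ≤-trans (count-∨ (R t) _ xs) (+-monoʳ-≤ (count (R t) xs) (count-any R ts xs))

count-++ : ∀ P xs ys → count P (xs ++ ys) ≡ count P xs + count P ys
count-++ P []       ys = refl
count-++ P (x ∷ xs) ys with P x
... | true  = cong suc (count-++ P xs ys)
... | false = count-++ P xs ys

count-concatMap : ∀ P (g : ℕ → List (List ℕ)) ys →
  count P (concatMap g ys) ≡ sum (map (count P ∘ g) ys)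
count-concatMap P g []       = refl
count-concatMap P g (y ∷ ys) =
  trans (count-++ P (g y) _) (cong (count P (g y) +_) (count-concatMap P g ys))

count-cons : ∀ P y zs → count P (map (y ∷_) zs) ≡ count (λ z → P (y ∷ z)) zs
count-cons P y []       = refl
count-cons P y (z ∷ zs) with P (y ∷ z)
... | true  = cong suc (count-cons P y zs)
... | false = count-cons P y zs

-- Compositions: ncomp L s = #{(y₁,…,y_L) ∈ ℕ^L | Σ yᵢ = s} = C(s+L-1, L-1),
-- and countC P L s counts those satisfying P.
countC : (List ℕ → Bool) → ℕ → ℕ → ℕ
countC P L s = count P (compositions L s)

ncomp : ℕ → ℕ → ℕ
ncomp L s = length (compositions L s)

countC-suc : ∀ P L s →
  countC P (suc L) s ≡ sumUpTo (λ y → countC (λ z → P (y ∷ z)) L (s ∸ y)) (suc s)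
countC-suc P L s = begin
  countC P (suc L) s
    ≡⟨ count-concatMap P (λ y → map (y ∷_) (compositions L (s ∸ y))) (upTo (suc s)) ⟩
  sum (map (λ y → count P (map (y ∷_) (compositions L (s ∸ y)))) (upTo (suc s)))
    ≡⟨ cong sum (map-upTo _ (suc s)) ⟩
  sumUpTo (λ y → count P (map (y ∷_) (compositions L (s ∸ y)))) (suc s)
    ≡⟨ sumUpTo-cong (suc s) (λ y → count-cons P y (compositions L (s ∸ y))) ⟩
  sumUpTo (λ y → countC (λ z → P (y ∷ z)) L (s ∸ y)) (suc s)
    ∎
  where open ≡-Reasoning

ncomp-suc : ∀ L s → ncomp (suc L) s ≡ sumUpTo (λ y → ncomp L (s ∸ y)) (suc s)
ncomp-suc L s = begin
  ncomp (suc L) s                                         ≡⟨ count-true (compositions (suc L) s) ⟨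
  countC (λ _ → true) (suc L) s                           ≡⟨ countC-suc (λ _ → true) L s ⟩
  sumUpTo (λ y → countC (λ _ → true) L (s ∸ y)) (suc s)   ≡⟨ sumUpTo-cong (suc s) (λ y → count-true (compositions L (s ∸ y))) ⟩
  sumUpTo (λ y → ncomp L (s ∸ y)) (suc s)                 ∎
  where open ≡-Reasoning

-- Pascal's rule: the first entry of a composition of s+1 is either 0 or positive.
ncomp-pascal : ∀ L s → ncomp (suc L) (suc s) ≡ ncomp (suc L) s + ncomp L (suc s)
ncomp-pascal L s rewrite ncomp-suc L (suc s) | ncomp-suc L s = +-comm (ncomp L (suc s)) _

ncomp-zero : ∀ L → ncomp L 0 ≡ 1
ncomp-zero zero    = refl
ncomp-zero (suc L) rewrite ncomp-suc L 0 | ncomp-zero L = refl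

ncomp-one : ∀ s → ncomp 1 s ≡ 1
ncomp-one zero    = refl
ncomp-one (suc s) = trans (ncomp-pascal 0 s) (trans (+-identityʳ _) (ncomp-one s))

ncomp-absorb : ∀ L s → (s + L) * ncomp L s ≡ L * ncomp (suc L) s
ncomp-absorb zero    zero    = refl
ncomp-absorb zero    (suc s) = *-zeroʳ (suc s + 0)
ncomp-absorb (suc L) zero    rewrite ncomp-zero (suc L) | ncomp-zero (suc (suc L)) = refl
ncomp-absorb (suc L) (suc s) = begin
  (suc s + suc L) * D                        ≡⟨ cong ((suc s + suc L) *_) (ncomp-pascal L s) ⟩
  (suc s + suc L) * (A + B)                  ≡⟨ split s L A B ⟩
  (s + suc L) * A + (suc s + L) * B + (A + B) ≡⟨ cong₂ (λ u v → u + v + (A + B)) (ncomp-absorb (suc L) s) (ncomp-absorb L (suc s)) ⟩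
  suc L * C + L * D + (A + B)                ≡⟨ cong (suc L * C + L * D +_) (ncomp-pascal L s) ⟨
  suc L * C + L * D + D                      ≡⟨ merge L C D ⟩
  suc L * (C + D)                            ≡⟨ cong (suc L *_) (ncomp-pascal (suc L) s) ⟨
  suc L * ncomp (suc (suc L)) (suc s)        ∎
  where
  open ≡-Reasoning
  A = ncomp (suc L) s
  B = ncomp L (suc s)
  C = ncomp (suc (suc L)) s
  D = ncomp (suc L) (suc s)
  split : ∀ s L A B → (suc s + suc L) * (A + B) ≡ (s + suc L) * A + (suc s + L) * B + (A + B)
  split = solve-∀
  merge : ∀ L C D → suc L * C + L * D + D ≡ suc L * (C + D)
  merge = solve-∀

ncomp-monoˢ : ∀ L {s s′} → s′ ≤ s → ncomp (suc L) s′ ≤ ncomp (suc L) s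
ncomp-monoˢ L {s} s′≤s with ≤⇒≤′ s′≤s
... | ≤′-refl       = ≤-refl
... | ≤′-step {s} p rewrite ncomp-pascal L s = ≤-trans (ncomp-monoˢ L (≤′⇒≤ p)) (m≤m+n _ _)

ncomp-lower : ∀ L s → suc s ≤ ncomp (suc (suc L)) s
ncomp-lower L zero    = ≤-reflexive (sym (ncomp-zero (suc (suc L))))
ncomp-lower L (suc s) rewrite ncomp-pascal (suc L) s =
  ≤-trans (≤-reflexive (+-comm 1 (suc s)))
    (+-mono-≤ (ncomp-lower L s) (≤-trans (≤-reflexive (sym (ncomp-zero (suc L)))) (ncomp-monoˢ L z≤n)))

ncomp-upper : ∀ L s → ncomp L s ≤ 2 ^ (s + L)
ncomp-upper zero    zero    = s≤s z≤n
ncomp-upper zero    (suc s) = z≤n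
ncomp-upper (suc L) zero    rewrite ncomp-zero (suc L) = m^n>0 2 (suc L)
ncomp-upper (suc L) (suc s) rewrite ncomp-pascal L s = begin
  ncomp (suc L) s + ncomp L (suc s)   ≤⟨ +-mono-≤ (ncomp-upper (suc L) s) (ncomp-upper L (suc s)) ⟩
  2 ^ (s + suc L) + 2 ^ (suc s + L)   ≡⟨ cong (λ e → 2 ^ (s + suc L) + 2 ^ e) (+-suc s L) ⟨
  2 ^ (s + suc L) + 2 ^ (s + suc L)   ≡⟨ cong (2 ^ (s + suc L) +_) (+-identityʳ _) ⟨
  2 ^ (suc s + suc L)                 ∎
  where open ≤-Reasoning

pow≤fact*ncomp : ∀ x j → x ^ j ≤ j ! * ncomp (suc j) x
pow≤fact*ncomp x zero    rewrite ncomp-one x = ≤-refl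
pow≤fact*ncomp x (suc j) = begin
  x * x ^ j                                     ≤⟨ *-mono-≤ (m≤m+n x (suc j)) (pow≤fact*ncomp x j) ⟩
  (x + suc j) * (j ! * ncomp (suc j) x)          ≡⟨ swap (x + suc j) (j !) _ ⟩
  j ! * ((x + suc j) * ncomp (suc j) x)          ≡⟨ cong (j ! *_) (ncomp-absorb (suc j) x) ⟩
  j ! * (suc j * ncomp (suc (suc j)) x)          ≡⟨ swap (j !) (suc j) _ ⟩
  suc j * (j ! * ncomp (suc (suc j)) x)          ≡⟨ *-assoc (suc j) (j !) _ ⟨
  suc j ! * ncomp (suc (suc j)) x                ∎
  where
  open ≤-Reasoning
  swap : ∀ a b c → a * (b * c) ≡ b * (a * c)
  swap = solve-∀

ncomp-ratio-step : ∀ L s → s * ncomp L s ≤ L * ncomp (suc L) s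
ncomp-ratio-step L s = ≤-trans (*-monoˡ-≤ (ncomp L s) (m≤m+n s L)) (≤-reflexive (ncomp-absorb L s))

ncomp-ratio : ∀ k L s → s ^ k * ncomp L s ≤ (k + L) ^ k * ncomp (k + L) s
ncomp-ratio zero    L s = ≤-refl
ncomp-ratio (suc k) L s = begin
  s * s ^ k * ncomp L s                              ≡⟨ *-assoc s (s ^ k) _ ⟩
  s * (s ^ k * ncomp L s)                            ≤⟨ *-monoʳ-≤ s (ncomp-ratio k L s) ⟩
  s * ((k + L) ^ k * ncomp (k + L) s)                ≡⟨ swap s ((k + L) ^ k) _ ⟩
  (k + L) ^ k * (s * ncomp (k + L) s)                ≤⟨ *-monoʳ-≤ ((k + L) ^ k) (ncomp-ratio-step (k + L) s) ⟩
  (k + L) ^ k * ((k + L) * ncomp (suc k + L) s)      ≡⟨ regroup ((k + L) ^ k) (k + L) _ ⟩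
  (k + L) ^ suc k * ncomp (suc k + L) s              ≤⟨ *-monoˡ-≤ _ (^-monoˡ-≤ (suc k) (n≤1+n (k + L))) ⟩
  (suc k + L) ^ suc k * ncomp (suc k + L) s          ∎
  where
  open ≤-Reasoning
  swap : ∀ a b c → a * (b * c) ≡ b * (a * c)
  swap = solve-∀
  regroup : ∀ p a c → p * (a * c) ≡ a * p * c
  regroup = solve-∀

boundedPrefix : (ℕ → ℕ) → ℕ → List ℕ → Bool
boundedPrefix f zero    z       = true
boundedPrefix f (suc k) []      = true
boundedPrefix f (suc k) (y ∷ z) = (y ≤ᵇ f 0) ∧ boundedPrefix (f ∘ suc) k z

-- Each of the k bounded entries has at most f(i-1) + 1 values, and the remaining
-- L + 1 entries form a composition of some w ≤ u; having at least one free part is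
-- what makes that count monotone in w, hence at most C(L+1) at total u.
boundedPrefix-count : ∀ f k L {w u} → w ≤ u →
  countC (boundedPrefix f k) (k + suc L) w ≤ product (applyUpTo (suc ∘ f) k) * ncomp (suc L) u
boundedPrefix-count f zero L {w} {u} w≤u = begin
  countC (λ _ → true) (suc L) w   ≡⟨ count-true (compositions (suc L) w) ⟩
  ncomp (suc L) w                 ≤⟨ ncomp-monoˢ L w≤u ⟩
  ncomp (suc L) u                 ≡⟨ *-identityˡ _ ⟨
  1 * ncomp (suc L) u             ∎
  where open ≤-Reasoning
boundedPrefix-count f (suc k) L {w} {u} w≤u = begin
  countC (boundedPrefix f (suc k)) (suc (k + suc L)) w
    ≡⟨ countC-suc (boundedPrefix f (suc k)) (k + suc L) w ⟩
  sumUpTo (λ y → countC (λ z → (y ≤ᵇ f 0) ∧ Rest z) (k + suc L) (w ∸ y)) (suc w)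
    ≡⟨ sumUpTo-cong (suc w) (λ y → count-∧ (y ≤ᵇ f 0) Rest (compositions (k + suc L) (w ∸ y))) ⟩
  sumUpTo (λ y → if y ≤ᵇ f 0 then countC Rest (k + suc L) (w ∸ y) else 0) (suc w)
    ≤⟨ sumUpTo-guarded (f 0) _ (suc w) (λ y → boundedPrefix-count (f ∘ suc) k L (≤-trans (m∸n≤m w y) w≤u)) ⟩
  suc (f 0) * (product (applyUpTo (suc ∘ f ∘ suc) k) * ncomp (suc L) u)
    ≡⟨ *-assoc (suc (f 0)) (product (applyUpTo (suc ∘ f ∘ suc) k)) (ncomp (suc L) u) ⟨
  product (applyUpTo (suc ∘ f) (suc k)) * ncomp (suc L) u
    ∎
  where
  open ≤-Reasoning
  Rest = boundedPrefix (f ∘ suc) k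

-- A first entry bounded by 0 is forced to be 0, so it costs nothing; this case
-- needs no free part after the prefix.
boundedPrefix-count₀ : ∀ f k L u → f 0 ≡ 0 →
  countC (boundedPrefix f (suc k)) (suc L) u ≡ countC (boundedPrefix (f ∘ suc) k) L u
boundedPrefix-count₀ f k L u f0≡0 = begin
  countC (boundedPrefix f (suc k)) (suc L) u
    ≡⟨ countC-suc (boundedPrefix f (suc k)) L u ⟩
  sumUpTo (λ y → countC (λ z → (y ≤ᵇ f 0) ∧ Rest z) L (u ∸ y)) (suc u)
    ≡⟨ cong (λ b → sumUpTo (λ y → countC (λ z → (y ≤ᵇ b) ∧ Rest z) L (u ∸ y)) (suc u)) f0≡0 ⟩
  countC Rest L u + sumUpTo (λ y → countC (λ _ → false) L (u ∸ suc y)) u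
    ≡⟨ cong (countC Rest L u +_) (sumUpTo-cong u (λ y → count-false (compositions L (u ∸ suc y)))) ⟩
  countC Rest L u + sumUpTo (λ _ → 0) u
    ≡⟨ cong (countC Rest L u +_) (sumUpTo-zero u) ⟩
  countC Rest L u + 0
    ≡⟨ +-identityʳ _ ⟩
  countC Rest L u
    ∎
  where
  open ≡-Reasoning
  Rest = boundedPrefix (f ∘ suc) k

boundedBy⇒boundedPrefix : ∀ f k z → all (λ i → at z (suc i) ≤ᵇ f i) (upTo (length z)) ≡ true →
  boundedPrefix f k z ≡ true
boundedBy⇒boundedPrefix f zero    z       _ = refl
boundedBy⇒boundedPrefix f (suc k) []      _ = refl
boundedBy⇒boundedPrefix f (suc k) (y ∷ z) h with y ≤ᵇ f 0
... | false = h
... | true  = boundedBy⇒boundedPrefix (f ∘ suc) k z (begin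
  and (map (λ i → at z (suc i) ≤ᵇ f (suc i)) (upTo (length z)))  ≡⟨ cong and (map-upTo _ (length z)) ⟩
  and (applyUpTo (λ i → at z (suc i) ≤ᵇ f (suc i)) (length z))    ≡⟨ cong and (map-applyUpTo suc _ (length z)) ⟨
  and (map (λ i → at (y ∷ z) (suc i) ≤ᵇ f i) (applyUpTo suc (length z))) ≡⟨ h ⟩
  true                                                              ∎)
  where open ≡-Reasoning

decomposableAt-cons : ∀ y z j → decomposableAt (y ∷ z) (suc j) ≡ decomposableAt z j
decomposableAt-cons y z j = cong and (map-cong entry (upTo (length z ∸ j)))
  where
  entry : ∀ i → (at (y ∷ z) (suc j + suc i) ≤ᵇ i) ≡ (at z (j + suc i) ≤ᵇ i)
  entry i rewrite +-suc j i = refl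

decomposable⇒boundedPrefix : ∀ j k z → decomposableAt z j ≡ true → boundedPrefix id k (drop j z) ≡ true
decomposable⇒boundedPrefix zero    k z       h = boundedBy⇒boundedPrefix id k z h
decomposable⇒boundedPrefix (suc j) k []      h = boundedBy⇒boundedPrefix id k [] refl
decomposable⇒boundedPrefix (suc j) k (y ∷ z) h =
  decomposable⇒boundedPrefix j k z (trans (sym (decomposableAt-cons y z j)) h)

countC-drop : ∀ P c M M′ → (∀ u → countC P M u ≤ c * ncomp M′ u) →
  ∀ j u → countC (P ∘ drop j) (j + M) u ≤ c * ncomp (j + M′) u
countC-drop P c M M′ bound zero    u = bound u
countC-drop P c M M′ bound (suc j) u = begin
  countC (P ∘ drop (suc j)) (suc (j + M)) u
    ≡⟨ countC-suc (P ∘ drop (suc j)) (j + M) u ⟩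
  sumUpTo (λ y → countC (P ∘ drop j) (j + M) (u ∸ y)) (suc u)
    ≤⟨ sumUpTo-mono (suc u) (λ y → countC-drop P c M M′ bound j (u ∸ y)) ⟩
  sumUpTo (λ y → c * ncomp (j + M′) (u ∸ y)) (suc u)
    ≡⟨ sumUpTo-scale c (λ y → ncomp (j + M′) (u ∸ y)) (suc u) ⟩
  c * sumUpTo (λ y → ncomp (j + M′) (u ∸ y)) (suc u)
    ≡⟨ cong (c *_) (ncomp-suc (j + M′) u) ⟨
  c * ncomp (suc (j + M′)) u
    ∎
  where open ≤-Reasoning

decAt : ℕ → List ℕ → Bool
decAt j z = decomposableAt z j

-- Decomposable at j, with a tail of length L + 1: the entry after j is 0.
decomposable-count₁ : ∀ j L u → countC (decAt j) (j + suc L) u ≤ ncomp (j + L) u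
decomposable-count₁ j L u = begin
  countC (decAt j) (j + suc L) u
    ≤⟨ count-mono (compositions (j + suc L) u) (decomposable⇒boundedPrefix j 1) ⟩
  countC (boundedPrefix id 1 ∘ drop j) (j + suc L) u
    ≤⟨ countC-drop (boundedPrefix id 1) 1 (suc L) L firstEntryZero j u ⟩
  1 * ncomp (j + L) u
    ≡⟨ *-identityˡ _ ⟩
  ncomp (j + L) u
    ∎
  where
  open ≤-Reasoning
  firstEntryZero : ∀ u → countC (boundedPrefix id 1) (suc L) u ≤ 1 * ncomp L u
  firstEntryZero u = ≤-reflexive (trans (boundedPrefix-count₀ id 0 L u refl)
                                 (trans (count-true (compositions L u)) (sym (*-identityˡ _))))

-- Decomposable at j, with a tail of length at least 4: the three entries after j
-- are bounded by 0, 1, 2, leaving 1 · 2 · 3 = 6 choices.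
decomposable-count₃ : ∀ j L u → countC (decAt j) (j + (3 + suc L)) u ≤ 6 * ncomp (j + suc L) u
decomposable-count₃ j L u = ≤-trans
  (count-mono (compositions (j + (3 + suc L)) u) (decomposable⇒boundedPrefix j 3))
  (countC-drop (boundedPrefix id 3) 6 (3 + suc L) (suc L) threeBounded j u)
  where
  threeBounded : ∀ u → countC (boundedPrefix id 3) (3 + suc L) u ≤ 6 * ncomp (suc L) u
  threeBounded u = ≤-trans (≤-reflexive (boundedPrefix-count₀ id 2 (2 + suc L) u refl))
                           (boundedPrefix-count suc 2 L ≤-refl)

decomposable-near : ∀ {j N} u → j < N → countC (decAt j) N u ≤ ncomp (N ∸ 1) u
decomposable-near {j} u j<N with d , refl ← m≤n⇒∃[o]m+o≡n j<N =
  subst (λ M → countC (decAt j) M u ≤ ncomp (j + d) u) (+-suc j d) (decomposable-count₁ j d u)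

decomposable-far : ∀ {j N} u → 3 + j < N → countC (decAt j) N u ≤ 6 * ncomp (N ∸ 3) u
decomposable-far {j} u 3+j<N with d , refl ← m≤n⇒∃[o]m+o≡n 3+j<N =
  subst₂ (λ M K → countC (decAt j) M u ≤ 6 * ncomp K u) (shape j d) (+-suc j d) (decomposable-count₃ j d u)
  where
  shape : ∀ j d → j + (3 + suc d) ≡ 4 + (j + d)
  shape = solve-∀

sumUpTo-split : ∀ d A B ν {f : ℕ → ℕ} → (∀ t → t < ν → f t ≤ A) → (∀ t → t + d < ν → f t ≤ B) →
  sumUpTo f ν ≤ d * A + ν * B
sumUpTo-split d A B zero          near far = z≤n
sumUpTo-split d A B (suc ν) {f} near far with suc ν ≤? d
... | yes ν≤d = begin
  sumUpTo f (suc ν)       ≤⟨ sumUpTo-bounded A (suc ν) near ⟩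
  suc ν * A               ≤⟨ *-monoˡ-≤ A ν≤d ⟩
  d * A                   ≤⟨ m≤m+n (d * A) _ ⟩
  d * A + suc ν * B       ∎
  where open ≤-Reasoning
... | no  ν≰d = begin
  f 0 + sumUpTo (f ∘ suc) ν   ≤⟨ +-mono-≤ (far 0 (≰⇒> ν≰d)) (sumUpTo-split d A B ν (λ t → near (suc t) ∘ s≤s) (λ t → far (suc t) ∘ s≤s)) ⟩
  B + (d * A + ν * B)         ≡⟨ rearrange B (d * A) ν ⟩
  d * A + suc ν * B           ∎
  where
  open ≤-Reasoning
  rearrange : ∀ B a ν → B + (a + ν * B) ≡ a + suc ν * B
  rearrange = solve-∀

length-split : ∀ n ν → 2 * ν ≤ n → n ∸ ν ≡ (n ∸ 2 * ν) + ν
length-split n ν 2ν≤n = begin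
  n ∸ ν                         ≡⟨ cong (_∸ ν) (m∸n+n≡m 2ν≤n) ⟨
  (n ∸ 2 * ν) + 2 * ν ∸ ν       ≡⟨ cong (_∸ ν) (regroup (n ∸ 2 * ν) ν) ⟩
  (n ∸ 2 * ν) + ν + ν ∸ ν       ≡⟨ m+n∸n≡m _ ν ⟩
  (n ∸ 2 * ν) + ν               ∎
  where
  open ≡-Reasoning
  regroup : ∀ p ν → p + 2 * ν ≡ p + ν + ν
  regroup = solve-∀

badEvent-count : ∀ n ν s → 2 * ν ≤ n →
  countC (badEvent n ν) (n ∸ ν) s ≤ 3 * ncomp (n ∸ ν ∸ 1) s + ν * (6 * ncomp (n ∸ ν ∸ 3) s)
badEvent-count n ν s 2ν≤n = begin
  countC (badEvent n ν) N s
    ≤⟨ count-any (λ t → decAt (p + t)) (upTo ν) (compositions N s) ⟩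
  sum (map (λ t → countC (decAt (p + t)) N s) (upTo ν))
    ≡⟨ cong sum (map-upTo _ ν) ⟩
  sumUpTo (λ t → countC (decAt (p + t)) N s) ν
    ≤⟨ sumUpTo-split 3 _ _ ν near far ⟩
  3 * ncomp (N ∸ 1) s + ν * (6 * ncomp (N ∸ 3) s)
    ∎
  where
  open ≤-Reasoning
  N = n ∸ ν
  p = n ∸ 2 * ν
  inside : ∀ {i t} → i + t < ν → i + (p + t) < N
  inside {i} {t} i+t<ν = subst (i + (p + t) <_) (sym (length-split n ν 2ν≤n))
    (subst (_< p + ν) (reorder i p t) (+-monoʳ-< p i+t<ν))
    where
    reorder : ∀ i p t → p + (i + t) ≡ i + (p + t)
    reorder = solve-∀
  near : ∀ t → t < ν → countC (decAt (p + t)) N s ≤ ncomp (N ∸ 1) s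
  near t t<ν = decomposable-near s (inside {0} t<ν)
  far : ∀ t → t + 3 < ν → countC (decAt (p + t)) N s ≤ 6 * ncomp (N ∸ 3) s
  far t t+3<ν = decomposable-far s (inside {3} (subst (_< ν) (+-comm t 3) t+3<ν))

-- The bad fraction in integers: for sequences of length N = L + 3 ≤ n with sum
-- s ≥ m/2, and ν n² ≤ 101 m², the bound of badEvent-count is at most
-- 2427 · (n/s) · C(N), using C(N-1) ≤ (N/s) C(N) and C(N-3) ≤ (N/s)³ C(N).
bad-fraction : ∀ {s m n ν L bad} → .{{NonZero s}} →
  m ≤ 2 * s → 3 + L ≤ n → ν * (n * n) ≤ 101 * (m * m) →
  bad ≤ 3 * ncomp (2 + L) s + ν * (6 * ncomp L s) →
  s * bad ≤ 2427 * (n * ncomp (3 + L) s)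
bad-fraction {s} {m} {n} {ν} {L} {bad} m≤2s N≤n ν-bound bad≤ = begin
  s * bad                        ≤⟨ *-monoʳ-≤ s bad≤ ⟩
  s * (3 * A + ν * (6 * B))      ≡⟨ expand s A ν B ⟩
  3 * (s * A) + 6 * (ν * s * B)  ≤⟨ +-mono-≤ (*-monoʳ-≤ 3 (≤-trans sA≤ (*-monoˡ-≤ T N≤n))) (*-monoʳ-≤ 6 far-part) ⟩
  3 * (n * T) + 6 * (404 * (n * T)) ≡⟨ collect (n * T) ⟩
  2427 * (n * T)                 ∎
  where
  N = 3 + L
  A = ncomp (2 + L) s
  B = ncomp L s
  T = ncomp N s
  open ≤-Reasoning
  sA≤ : s * A ≤ N * T
  sA≤ = ≤-trans (ncomp-ratio-step (2 + L) s) (*-monoˡ-≤ T (n≤1+n (2 + L)))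
  s³B≤ : s ^ 3 * B ≤ N ^ 3 * T
  s³B≤ = ncomp-ratio 3 L s
  expand : ∀ s A ν B → s * (3 * A + ν * (6 * B)) ≡ 3 * (s * A) + 6 * (ν * s * B)
  expand = solve-∀
  collect : ∀ x → 3 * x + 6 * (404 * x) ≡ 2427 * x
  collect = solve-∀
  cube : ∀ s ν B → s * s * (ν * s * B) ≡ ν * (s * (s * (s * 1)) * B)
  cube = solve-∀
  split : ∀ ν n T → ν * (n * (n * (n * 1)) * T) ≡ ν * (n * n) * (n * T)
  split = solve-∀
  square : ∀ s x → 101 * (2 * s * (2 * s)) * x ≡ s * s * (404 * x)
  square = solve-∀
  far-part : ν * s * B ≤ 404 * (n * T)
  far-part = *-cancelˡ-≤ (s * s) {{m*n≢0 s s}} (begin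
    s * s * (ν * s * B)          ≡⟨ cube s ν B ⟩
    ν * (s ^ 3 * B)              ≤⟨ *-monoʳ-≤ ν s³B≤ ⟩
    ν * (N ^ 3 * T)              ≤⟨ *-monoʳ-≤ ν (*-monoˡ-≤ T (^-monoˡ-≤ 3 N≤n)) ⟩
    ν * (n ^ 3 * T)              ≡⟨ split ν n T ⟩
    ν * (n * n) * (n * T)        ≤⟨ *-monoˡ-≤ (n * T) ν-bound ⟩
    101 * (m * m) * (n * T)      ≤⟨ *-monoˡ-≤ (n * T) (*-monoʳ-≤ 101 (*-mono-≤ m≤2s m≤2s)) ⟩
    101 * (2 * s * (2 * s)) * (n * T) ≡⟨ square s (n * T) ⟩
    s * s * (404 * (n * T))      ∎)

^-distrib-* : ∀ a b k → (a * b) ^ k ≡ a ^ k * b ^ k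
^-distrib-* a b zero    = refl
^-distrib-* a b (suc k) = begin
  a * b * (a * b) ^ k        ≡⟨ cong (a * b *_) (^-distrib-* a b k) ⟩
  a * b * (a ^ k * b ^ k)    ≡⟨ interchange a b (a ^ k) (b ^ k) ⟩
  a * a ^ k * (b * b ^ k)    ∎
  where
  open ≡-Reasoning
  interchange : ∀ a b c d → a * b * (c * d) ≡ a * c * (b * d)
  interchange = solve-∀

expNum-lower : ∀ B k → B ^ k ≤ expNum B k
expNum-lower B zero    = ≤-refl
expNum-lower B (suc k) = m≤n+m (B ^ suc k) (suc k * expNum B k)

fact≤pow : ∀ k → k ! ≤ k ^ k
fact≤pow zero    = ≤-refl
fact≤pow (suc k) = *-monoʳ-≤ (suc k) (≤-trans (fact≤pow k) (^-monoˡ-≤ k (n≤1+n k)))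

-- x ≤ 2^k and 2k ≤ B give x ≤ e^B, because 2^k ≤ (2k)^k / k! ≤ B^k / k!.
leExp-intro : ∀ {x B} k → x ≤ 2 ^ k → 2 * k ≤ B → LeExp x B
leExp-intro {x} {B} k x≤2^k 2k≤B = k , (begin
  x * k !            ≤⟨ *-mono-≤ x≤2^k (fact≤pow k) ⟩
  2 ^ k * k ^ k      ≡⟨ ^-distrib-* 2 k k ⟨
  (2 * k) ^ k        ≤⟨ ^-monoˡ-≤ k 2k≤B ⟩
  B ^ k              ≤⟨ expNum-lower B k ⟩
  expNum B k         ∎)
  where open ≤-Reasoning

-- (2B)^j / j! ≤ 2 · 16^B: compare (4B)^j / j! ≤ C(4B + j, j) ≤ 2^(4B + j + 1).
expTerm-upper : ∀ B j → (2 * B) ^ j ≤ 2 * 16 ^ B * j !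
expTerm-upper B j = *-cancelˡ-≤ (2 ^ j) {{m^n≢0 2 j}} (begin
  2 ^ j * (2 * B) ^ j                 ≡⟨ ^-distrib-* 2 (2 * B) j ⟨
  (2 * (2 * B)) ^ j                   ≡⟨ cong (_^ j) (*-assoc 2 2 B) ⟨
  (4 * B) ^ j                         ≤⟨ pow≤fact*ncomp (4 * B) j ⟩
  j ! * ncomp (suc j) (4 * B)         ≤⟨ *-monoʳ-≤ (j !) (ncomp-upper (suc j) (4 * B)) ⟩
  j ! * 2 ^ (4 * B + suc j)           ≡⟨ cong (j ! *_) (^-distribˡ-+-* 2 (4 * B) (suc j)) ⟩
  j ! * (2 ^ (4 * B) * 2 ^ suc j)     ≡⟨ cong (λ x → j ! * (x * 2 ^ suc j)) (^-*-assoc 2 4 B) ⟨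
  j ! * (16 ^ B * (2 * 2 ^ j))        ≡⟨ reorder (j !) (16 ^ B) (2 ^ j) ⟩
  2 ^ j * (2 * 16 ^ B * j !)          ∎)
  where
  open ≤-Reasoning
  reorder : ∀ f g p → f * (g * (2 * p)) ≡ p * (2 * g * f)
  reorder = solve-∀

-- Geometric-series invariant behind e^B ≤ 4 · 16^B: with G = 16^B, the terms of the
-- partial sum decay at least like 2 G / 2^j, so
-- 2^k · expNum B k + 2 G k! ≤ 4 G k! · 2^k.
expNum-geometric : ∀ B k → 2 ^ k * expNum B k + 2 * 16 ^ B * k ! ≤ 4 * 16 ^ B * k ! * 2 ^ k
expNum-geometric B zero = base (16 ^ B) (m^n>0 16 B)
  where
  base : ∀ G → 1 ≤ G → 1 + 2 * G * 1 ≤ 4 * G * 1 * 1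
  base G 1≤G = ≤-trans (+-monoˡ-≤ (2 * G * 1) 1≤G)
    (≤-trans (m≤m+n (G + 2 * G * 1) G) (≤-reflexive (four G)))
    where
    four : ∀ G → G + 2 * G * 1 + G ≡ 4 * G * 1 * 1
    four = solve-∀
expNum-geometric B (suc k) = begin
  2 * p * (suc k * e + b) + 2 * G * (suc k * F)           ≡⟨ expand p e b G F k ⟩
  2 * suc k * (p * e) + 2 * p * b + 2 * G * (suc k * F)   ≤⟨ +-monoˡ-≤ _ (+-monoʳ-≤ (2 * suc k * (p * e)) last-term) ⟩
  2 * suc k * (p * e) + 2 * G * (suc k * F) + 2 * G * (suc k * F) ≡⟨ collect p e G F k ⟩
  2 * suc k * (p * e + 2 * G * F)                          ≤⟨ *-monoʳ-≤ (2 * suc k) (expNum-geometric B k) ⟩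
  2 * suc k * (4 * G * F * p)                              ≡⟨ finish p G F k ⟩
  4 * G * (suc k * F) * (2 * p)                            ∎
  where
  open ≤-Reasoning
  p = 2 ^ k
  e = expNum B k
  b = B ^ suc k
  G = 16 ^ B
  F = k !
  last-term : 2 * p * b ≤ 2 * G * (suc k * F)
  last-term = ≤-trans (≤-reflexive (sym (^-distrib-* 2 B (suc k)))) (expTerm-upper B (suc k))
  expand : ∀ p e b G F k → 2 * p * (suc k * e + b) + 2 * G * (suc k * F) ≡ 2 * suc k * (p * e) + 2 * p * b + 2 * G * (suc k * F)
  expand = solve-∀
  collect : ∀ p e G F k → 2 * suc k * (p * e) + 2 * G * (suc k * F) + 2 * G * (suc k * F) ≡ 2 * suc k * (p * e + 2 * G * F)
  collect = solve-∀
  finish : ∀ p G F k → 2 * suc k * (4 * G * F * p) ≡ 4 * G * (suc k * F) * (2 * p)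
  finish = solve-∀

expNum-upper : ∀ B k → expNum B k ≤ 4 * 16 ^ B * k !
expNum-upper B k = *-cancelˡ-≤ (2 ^ k) {{m^n≢0 2 k}}
  (≤-trans (m≤m+n _ _) (≤-trans (expNum-geometric B k) (≤-reflexive (*-comm (4 * 16 ^ B * k !) (2 ^ k)))))

pow-cancel : ∀ {a b} k → .{{NonZero k}} → a ^ k ≤ b ^ k → a ≤ b
pow-cancel {a} {b} k aᵏ≤bᵏ with a ≤? b
... | yes a≤b = a≤b
... | no  a≰b = contradiction aᵏ≤bᵏ (<⇒≱ (^-monoˡ-< k (≰⇒> a≰b)))

-- Comparison in blocks of n factors: if n^n ≤ 2^M and 2 M (x + n) ≤ n B, then
-- n^x ≤ 2^(M q) ≤ e^B with q = ⌊x/n⌋ + 1 blocks.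
pow-leExp : ∀ {n M x B} → .{{NonZero n}} → n ^ n ≤ 2 ^ M → 2 * (M * (x + n)) ≤ n * B → LeExp (n ^ x) B
pow-leExp {n} {M} {x} {B} nⁿ≤2ᴹ budget = leExp-intro (M * q) nˣ≤2ᴹq 2Mq≤B
  where
  open ≤-Reasoning
  q = suc (x / n)
  x≤nq : x ≤ n * q
  x≤nq = begin
    x                   ≡⟨ m≡m%n+[m/n]*n x n ⟩
    x % n + x / n * n   ≤⟨ +-monoˡ-≤ (x / n * n) (<⇒≤ (m%n<n x n)) ⟩
    n + x / n * n       ≡⟨ cong (n +_) (*-comm (x / n) n) ⟩
    n + n * (x / n)     ≡⟨ *-suc n (x / n) ⟨
    n * q               ∎
  nq≤x+n : n * q ≤ x + n
  nq≤x+n = begin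
    n * q               ≡⟨ *-suc n (x / n) ⟩
    n + n * (x / n)     ≡⟨ cong (n +_) (*-comm n (x / n)) ⟩
    n + x / n * n       ≤⟨ +-monoʳ-≤ n (m/n*n≤m x n) ⟩
    n + x               ≡⟨ +-comm n x ⟩
    x + n               ∎
  nˣ≤2ᴹq : n ^ x ≤ 2 ^ (M * q)
  nˣ≤2ᴹq = begin
    n ^ x               ≤⟨ ^-monoʳ-≤ n x≤nq ⟩
    n ^ (n * q)         ≡⟨ ^-*-assoc n n q ⟨
    (n ^ n) ^ q         ≤⟨ ^-monoˡ-≤ q nⁿ≤2ᴹ ⟩
    (2 ^ M) ^ q         ≡⟨ ^-*-assoc 2 M q ⟩
    2 ^ (M * q)         ∎
  2Mq≤B : 2 * (M * q) ≤ B
  2Mq≤B = *-cancelˡ-≤ n (begin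
    n * (2 * (M * q))   ≡⟨ reorder n M q ⟩
    2 * (M * (n * q))   ≤⟨ *-monoʳ-≤ 2 (*-monoʳ-≤ M nq≤x+n) ⟩
    2 * (M * (x + n))   ≤⟨ budget ⟩
    n * B               ∎)
    where
    reorder : ∀ n M q → n * (2 * (M * q)) ≡ 2 * (M * (n * q))
    reorder = solve-∀

-- ½ log n ≤ α, i.e. n^n ≤ e^(2m) ≤ 4 · 16^(2m) = 2^(8m+2).
halfLog⇒pow : ∀ {n m} → HalfLogLeα n m → n ^ n ≤ 2 ^ (8 * m + 2)
halfLog⇒pow {n} {m} (k , nⁿk!≤) = begin
  n ^ n                 ≤⟨ *-cancelʳ-≤ (n ^ n) (4 * 16 ^ (2 * m)) (k !) {{k !≢0}} (≤-trans nⁿk!≤ (expNum-upper (2 * m) k)) ⟩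
  4 * 16 ^ (2 * m)      ≡⟨ cong (4 *_) (^-*-assoc 2 4 (2 * m)) ⟩
  4 * 2 ^ (4 * (2 * m)) ≡⟨ cong (λ e → 4 * 2 ^ e) (*-assoc 4 2 m) ⟨
  4 * 2 ^ (8 * m)       ≡⟨ *-comm 4 (2 ^ (8 * m)) ⟩
  2 ^ (8 * m) * 2 ^ 2   ≡⟨ ^-distribˡ-+-* 2 (8 * m) 2 ⟨
  2 ^ (8 * m + 2)       ∎
  where open ≤-Reasoning

-- For n ≥ 256 this forces n ≤ m, since otherwise 2^(8m+2) < 2^(8n) = 256^n ≤ n^n.
pow⇒n≤m : ∀ {n m} → 256 ≤ n → n ^ n ≤ 2 ^ (8 * m + 2) → n ≤ m
pow⇒n≤m {n} {m} 256≤n nⁿ≤ with n ≤? m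
... | yes n≤m = n≤m
... | no  n≰m = contradiction nⁿ≤ (<⇒≱ (begin-strict
  2 ^ (8 * m + 2)   <⟨ ^-monoʳ-< 2 (s≤s (s≤s z≤n)) exponent< ⟩
  2 ^ (8 * n)       ≡⟨ ^-*-assoc 2 8 n ⟨
  256 ^ n           ≤⟨ ^-monoˡ-≤ n 256≤n ⟩
  n ^ n             ∎))
  where
  open ≤-Reasoning
  exponent< : 8 * m + 2 < 8 * n
  exponent< = ≤-trans (m≤m+n (suc (8 * m + 2)) 5) (≤-trans (≤-reflexive (eight m)) (*-monoʳ-≤ 8 (≰⇒> n≰m)))
    where
    eight : ∀ m → suc (8 * m + 2) + 5 ≡ 8 * suc m
    eight = solve-∀

8m+2≤10m : ∀ {m} → 1 ≤ m → 8 * m + 2 ≤ 10 * m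
8m+2≤10m {m} 1≤m = ≤-trans (+-monoʳ-≤ (8 * m) (*-monoʳ-≤ 2 1≤m)) (≤-reflexive (ten m))
  where
  ten : ∀ m → 8 * m + 2 * m ≡ 10 * m
  ten = solve-∀

-- ν = ⌈2(α+1) log n⌉: ν - 1 < 2(α+1) log n, and log n ≤ (8m+2)/n gives ν n² ≤ 101 m².
ceiling⇒ν-bound : ∀ {n m ν} → .{{NonZero n}} → n ≤ m → n ^ n ≤ 2 ^ (8 * m + 2) →
  ¬ LeExp (n ^ (2 * (m + n))) ((ν ∸ 1) * n) → ν * (n * n) ≤ 101 * (m * m)
ceiling⇒ν-bound {n} {m} {ν} n≤m nⁿ≤ not-le = begin
  ν * (n * n)                  ≤⟨ peel ν ⟩
  n * ((ν ∸ 1) * n) + n * n    ≤⟨ +-mono-≤ (<⇒≤ (≰⇒> (not-le ∘ pow-leExp {M = 8 * m + 2} {x = 2 * (m + n)} nⁿ≤))) (*-mono-≤ n≤m n≤m) ⟩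
  2 * ((8 * m + 2) * (2 * (m + n) + n)) + m * m
    ≤⟨ +-monoˡ-≤ (m * m) (*-monoʳ-≤ 2 (*-mono-≤ (8m+2≤10m (≤-trans (>-nonZero⁻¹ n) n≤m)) x+n≤5m)) ⟩
  2 * (10 * m * (5 * m)) + m * m ≡⟨ collect m ⟩
  101 * (m * m)                ∎
  where
  open ≤-Reasoning
  x+n≤5m : 2 * (m + n) + n ≤ 5 * m
  x+n≤5m = ≤-trans (+-mono-≤ (*-monoʳ-≤ 2 (+-monoʳ-≤ m n≤m)) n≤m) (≤-reflexive (five m))
    where
    five : ∀ m → 2 * (m + m) + m ≡ 5 * m
    five = solve-∀
  peel : ∀ ν → ν * (n * n) ≤ n * ((ν ∸ 1) * n) + n * n
  peel zero    = z≤n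
  peel (suc ν) = ≤-reflexive (shift ν n)
    where
    shift : ∀ ν n → suc ν * (n * n) ≡ n * (ν * n) + n * n
    shift = solve-∀
  collect : ∀ m → 2 * (10 * m * (5 * m)) + m * m ≡ 101 * (m * m)
  collect = solve-∀

-- α ≤ log n, i.e. e^m ≤ n^n, gives m^(8n) ≤ n^n (8n)! ≤ (n (8n)^8)^n.
log⇒m-upper : ∀ {n m} → .{{NonZero n}} → αLeLog n m → m ^ 8 ≤ n * (8 * n) ^ 8
log⇒m-upper {n} {m} eᵐ≤nⁿ = pow-cancel n (begin
  (m ^ 8) ^ n                 ≡⟨ ^-*-assoc m 8 n ⟩
  m ^ (8 * n)                 ≤⟨ expNum-lower m (8 * n) ⟩
  expNum m (8 * n)            ≤⟨ eᵐ≤nⁿ (8 * n) ⟩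
  n ^ n * (8 * n) !           ≤⟨ *-monoʳ-≤ (n ^ n) (fact≤pow (8 * n)) ⟩
  n ^ n * (8 * n) ^ (8 * n)   ≡⟨ cong (n ^ n *_) (^-*-assoc (8 * n) 8 n) ⟨
  n ^ n * ((8 * n) ^ 8) ^ n   ≡⟨ ^-distrib-* n ((8 * n) ^ 8) n ⟨
  (n * (8 * n) ^ 8) ^ n       ∎)
  where open ≤-Reasoning

N₀ : ℕ
N₀ = 4 * (101 ^ 4 * 8 ^ 8)

256≤N₀ : 256 ≤ N₀
256≤N₀ = ≤ᵇ⇒≤ 256 N₀ _

large⇒nonZero : ∀ {n} → 256 ≤ n → NonZero n
large⇒nonZero 256≤n = >-nonZero (≤-trans (s≤s z≤n) 256≤n)

-- ν n² ≤ 101 m² and m^8 ≤ n (8n)^8 give ν⁴ n⁸ ≤ 101⁴ 8⁸ n · n⁸, so for n ≥ N₀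
-- we get (2ν²)² = 4ν⁴ ≤ N₀ n ≤ n²: the window has size ν = O(n^(1/4)).
ν-small : ∀ {n m ν} → .{{NonZero n}} → N₀ ≤ n →
  ν * (n * n) ≤ 101 * (m * m) → m ^ 8 ≤ n * (8 * n) ^ 8 → 2 * (ν * ν) ≤ n
ν-small {n} {m} {ν} N₀≤n ν-bound m-upper =
  subst (λ x → 2 * x ≤ n) (cong (ν *_) (*-identityʳ ν)) (pow-cancel 2 (begin
    (2 * ν ^ 2) ^ 2        ≡⟨ ^-distrib-* 2 (ν ^ 2) 2 ⟩
    4 * (ν ^ 2) ^ 2        ≡⟨ cong (4 *_) (^-*-assoc ν 2 2) ⟩
    4 * ν ^ 4              ≤⟨ *-monoʳ-≤ 4 ν⁴≤Kn ⟩
    4 * (K * n)            ≡⟨ *-assoc 4 K n ⟨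
    N₀ * n                 ≤⟨ *-monoˡ-≤ n N₀≤n ⟩
    n * n                  ≡⟨ cong (n *_) (*-identityʳ n) ⟨
    n ^ 2                  ∎))
  where
  open ≤-Reasoning
  K = 101 ^ 4 * 8 ^ 8
  square⁴ : ∀ x → (x * x) ^ 4 ≡ x ^ 8
  square⁴ x = trans (^-distrib-* x x 4) (sym (^-distribˡ-+-* x 4 4))
  regroup : ∀ a b c d → a * (c * (b * d)) ≡ a * b * c * d
  regroup = solve-∀
  ν⁴≤Kn : ν ^ 4 ≤ K * n
  ν⁴≤Kn = *-cancelʳ-≤ (ν ^ 4) (K * n) (n ^ 8) {{m^n≢0 n 8}} (begin
    ν ^ 4 * n ^ 8                  ≡⟨ cong (ν ^ 4 *_) (square⁴ n) ⟨
    ν ^ 4 * (n * n) ^ 4            ≡⟨ ^-distrib-* ν (n * n) 4 ⟨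
    (ν * (n * n)) ^ 4              ≤⟨ ^-monoˡ-≤ 4 ν-bound ⟩
    (101 * (m * m)) ^ 4            ≡⟨ ^-distrib-* 101 (m * m) 4 ⟩
    101 ^ 4 * (m * m) ^ 4          ≡⟨ cong (101 ^ 4 *_) (square⁴ m) ⟩
    101 ^ 4 * m ^ 8                ≤⟨ *-monoʳ-≤ (101 ^ 4) m-upper ⟩
    101 ^ 4 * (n * (8 * n) ^ 8)    ≡⟨ cong (λ x → 101 ^ 4 * (n * x)) (^-distrib-* 8 n 8) ⟩
    101 ^ 4 * (n * (8 ^ 8 * n ^ 8)) ≡⟨ regroup (101 ^ 4) (8 ^ 8) n (n ^ 8) ⟩
    K * n * n ^ 8                  ∎)

record Regime (n m ν : ℕ) : Set where
  field
    256≤n    : 256 ≤ n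
    n≤m      : n ≤ m
    nⁿ≤2ᴹ    : n ^ n ≤ 2 ^ (8 * m + 2)
    ν-bound  : ν * (n * n) ≤ 101 * (m * m)
    ν²-small : 2 * (ν * ν) ≤ n

regime : ∀ n m ν → N₀ ≤ n → HalfLogLeα n m → αLeLog n m → IsNu n m ν → Regime n m ν
regime n m ν N₀≤n half-log α≤log (_ , ν-ceiling) = record
  { 256≤n    = 256≤n
  ; n≤m      = n≤m
  ; nⁿ≤2ᴹ    = nⁿ≤2ᴹ
  ; ν-bound  = ν-bound
  ; ν²-small = ν-small {n} {m} {ν} {{n≢0}} N₀≤n ν-bound (log⇒m-upper {n} {m} {{n≢0}} α≤log)
  }
  where
  256≤n : 256 ≤ n
  256≤n = ≤-trans 256≤N₀ N₀≤n
  n≢0 : NonZero n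
  n≢0 = large⇒nonZero 256≤n
  nⁿ≤2ᴹ : n ^ n ≤ 2 ^ (8 * m + 2)
  nⁿ≤2ᴹ = halfLog⇒pow {n} {m} half-log
  n≤m : n ≤ m
  n≤m = pow⇒n≤m 256≤n nⁿ≤2ᴹ
  ν-bound : ν * (n * n) ≤ 101 * (m * m)
  ν-bound = ceiling⇒ν-bound {n} {m} {ν} {{n≢0}} n≤m nⁿ≤2ᴹ ν-ceiling

-- From s · bad ≤ 2427 n T to n^bad ≤ e^(97120 T), i.e. bad · log n ≤ 97120 T,
-- via log n ≤ (8m+2)/n ≤ 10m/n, m ≤ 2s and m ≤ 2T.
bad-leExp : ∀ {n m s T bad} → .{{NonZero n}} → 1 ≤ m → m ≤ 2 * s → m ≤ 2 * T →
  n ^ n ≤ 2 ^ (8 * m + 2) → s * bad ≤ 2427 * (n * T) → LeExp (n ^ bad) (97120 * T)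
bad-leExp {n} {m} {s} {T} {bad} 1≤m m≤2s m≤2T nⁿ≤2ᴹ s·bad≤ = pow-leExp {M = 8 * m + 2} {x = bad} nⁿ≤2ᴹ (begin
  2 * ((8 * m + 2) * (bad + n))              ≤⟨ *-monoʳ-≤ 2 (*-monoˡ-≤ (bad + n) (8m+2≤10m 1≤m)) ⟩
  2 * (10 * m * (bad + n))                   ≡⟨ expand m bad n ⟩
  20 * (m * bad) + 20 * (m * n)              ≤⟨ +-mono-≤ (*-monoʳ-≤ 20 m·bad≤) (*-monoʳ-≤ 20 (*-monoˡ-≤ n m≤2T)) ⟩
  20 * (4854 * (n * T)) + 20 * (2 * T * n)   ≡⟨ collect n T ⟩
  n * (97120 * T)                            ∎)
  where
  open ≤-Reasoning
  m·bad≤ : m * bad ≤ 4854 * (n * T)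
  m·bad≤ = begin
    m * bad               ≤⟨ *-monoˡ-≤ bad m≤2s ⟩
    2 * s * bad           ≡⟨ *-assoc 2 s bad ⟩
    2 * (s * bad)         ≤⟨ *-monoʳ-≤ 2 s·bad≤ ⟩
    2 * (2427 * (n * T))  ≡⟨ *-assoc 2 2427 (n * T) ⟨
    4854 * (n * T)        ∎
  expand : ∀ m b n → 2 * (10 * m * (b + n)) ≡ 20 * (m * b) + 20 * (m * n)
  expand = solve-∀
  collect : ∀ n T → 20 * (4854 * (n * T)) + 20 * (2 * T * n) ≡ n * (97120 * T)
  collect = solve-∀

half-remains : ∀ a {m} → 2 * a ≤ m → m ≤ 2 * (m ∸ a)
half-remains a {m} 2a≤m = begin
  m                    ≤⟨ m≤n+m∸n m a ⟩
  a + (m ∸ a)          ≤⟨ +-monoˡ-≤ (m ∸ a) (m+n≤o⇒m≤o∸n a (≤-trans (≤-reflexive (double a)) 2a≤m)) ⟩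
  (m ∸ a) + (m ∸ a)    ≡⟨ double (m ∸ a) ⟩
  2 * (m ∸ a)          ∎
  where
  open ≤-Reasoning
  double : ∀ x → x + x ≡ 2 * x
  double = solve-∀

bad-probability : ∀ n m ν a → Regime n m ν → a ≤ ν * ν →
  LeExp (n ^ countC (badEvent n ν) (n ∸ ν) (m ∸ a)) (97120 * ncomp (n ∸ ν) (m ∸ a))
bad-probability n m ν a R a≤ν² =
  subst (λ N → LeExp (n ^ countC (badEvent n ν) N s) (97120 * ncomp N s)) (m+[n∸m]≡n 3≤N)
    (bad-leExp {n} {m} {s} {T} {bad} {{n≢0}} 1≤m m≤2s m≤2T nⁿ≤2ᴹ
      (bad-fraction {s} {m} {n} {ν} {L} {bad} {{s≢0}} m≤2s N≤n ν-bound bad≤))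
  where
  open Regime R
  s = m ∸ a
  L = n ∸ ν ∸ 3
  T = ncomp (3 + L) s
  bad = countC (badEvent n ν) (3 + L) s
  ν≤ν² : ∀ ν → ν ≤ ν * ν
  ν≤ν² zero    = z≤n
  ν≤ν² (suc ν) = m≤m*n (suc ν) (suc ν)
  2ν≤n : 2 * ν ≤ n
  2ν≤n = ≤-trans (*-monoʳ-≤ 2 (ν≤ν² ν)) ν²-small
  m≤2s : m ≤ 2 * s
  m≤2s = half-remains a (≤-trans (*-monoʳ-≤ 2 a≤ν²) (≤-trans ν²-small n≤m))
  n≢0 : NonZero n
  n≢0 = large⇒nonZero 256≤n
  1≤m : 1 ≤ m
  1≤m = ≤-trans (≤-trans (s≤s z≤n) 256≤n) n≤m
  s≢0 : NonZero s
  s≢0 = >-nonZero (*-cancelˡ-< 2 0 s (≤-trans 1≤m m≤2s))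
  3≤N : 3 ≤ n ∸ ν
  3≤N = *-cancelˡ-≤ 2 (≤-trans (≤-trans (≤ᵇ⇒≤ 6 256 _) 256≤n) (half-remains ν 2ν≤n))
  N≤n : 3 + L ≤ n
  N≤n = subst (_≤ n) (sym (m+[n∸m]≡n 3≤N)) (m∸n≤m n ν)
  bad≤ : countC (badEvent n ν) (3 + L) s ≤ 3 * ncomp (2 + L) s + ν * (6 * ncomp L s)
  bad≤ = subst (λ N → countC (badEvent n ν) N s ≤ 3 * ncomp (N ∸ 1) s + ν * (6 * ncomp (N ∸ 3) s))
    (sym (m+[n∸m]≡n 3≤N)) (badEvent-count n ν s 2ν≤n)
  m≤2T : m ≤ 2 * T
  m≤2T = ≤-trans m≤2s (*-monoʳ-≤ 2 (≤-trans (n≤1+n s) (ncomp-lower (suc L) s)))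

sumFin-bounded : ∀ {ν} K (a : Fin ν → ℕ) → (∀ i → a i ≤ K) → sumFin a ≤ ν * K
sumFin-bounded {zero}  K a a≤K = z≤n
sumFin-bounded {suc ν} K a a≤K = +-mono-≤ (a≤K Fin.zero) (sumFin-bounded K (a ∘ Fin.suc) (a≤K ∘ Fin.suc))

lemma3p7 : Σ ℕ λ C → Σ ℕ λ N →
    (n m ν : ℕ) → N ≤ n → HalfLogLeα n m → αLeLog n m → IsNu n m ν →
    (a : Fin ν → ℕ) → ((i : Fin ν) → a i ≤ toℕ i) →
    LeExp (n ^ length (filterᵇ (badEvent n ν) (𝒴₁ n m ν (sumFin a))))
    (C * length (𝒴₁ n m ν (sumFin a)))
lemma3p7 = 97120 , N₀ , λ n m ν N₀≤n half-log α≤log is-ν a a≤i →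
  bad-probability n m ν (sumFin a) (regime n m ν N₀≤n half-log α≤log is-ν)
    (sumFin-bounded ν a (λ i → <⇒≤ (≤-<-trans (a≤i i) (toℕ<n i))))
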